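{- Let $A=(a_i)_{i\ge1}$ be a weakly increasing multisubset of $\mathbb{N}$ such that $\underline{d}(A^{\#})=1$, and let $\epsilon>0$. Then for all sufficiently large integers $h$ (depending on $\epsilon$) there exist a positive integer $n$ and a set $\mathscr{J}\subseteq A^{\#}\cap[a_n,(1+\epsilon)a_n]$ such that $$h=\sum_{i=1}^{n}a_i+\sum_{x\in\mathscr{J}}x .$$ Moreover $n$ (which depends on $h$) can be chosen so that $n\to\infty$ as $h\to\infty$.
   Context: $\mathbb{N}$ is the set of positive integers. A multisubset $A$ of $\mathbb{N}$ is a collection of positive integers with repetitions allowed, each integer occurring only finitely many times; writing its elements in non-decreasing order $a_1\le a_2\le\cdots$ we write $A=(a_i)$. $A$ is weakly increasing if for each $\epsilon>0$ there exists $\delta>0$ such that for all sufficiently large $n$ (depending on $\epsilon$), $a_{\lfloor(1+\epsilon)n\rfloor}/a_n>1+\delta$. $A^{\#}\subseteq\mathbb{N}$ is the set of integers appearing at least once in $A$. For $X\subseteq\mathbb{N}$, the lower asymptotic density is $\underline{d}(X)=\liminf_{n\to\infty}|X\cap[1,n]|/n$.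
   Formalization: The parameter ε of the lemma takes only positive rational values. -}

module Defs where

open import Data.Nat using (ℕ; zero; suc; pred; _+_; _*_; _≤_; _<_; _/_)
open import Data.Product using (Σ; ∃; ∃-syntax; _×_)
open import Data.Fin using (Fin)
open import Data.List using (List)
open import Data.Nat.ListAction using (sum)
open import Data.List.Relation.Unary.All using (All)
open import Data.List.Relation.Unary.Unique.Propositional using (Unique)
open import Function.Definitions using (Injective)
open import Relation.Binary.PropositionalEquality using (_≡_)

-- A multisubset A = (a_i)_{i ≥ 1} of ℕ is given by the non-decreasing
-- enumeration a : ℕ → ℕ, where a i is a_i for i ≥ 1 (the value a 0 is ignored).
record IsMultisubset (a : ℕ → ℕ) : Set where
  field
    positive   : ∀ i → 1 ≤ i → 1 ≤ a i
    monotone   : ∀ i → 1 ≤ i → a i ≤ a (suc i)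
    finiteMult : ∀ m → ∃[ B ] (∀ i → 1 ≤ i → a i ≡ m → i ≤ B)

-- Weakly increasing: for each ε = p/q > 0 there is δ = r/s > 0 such that
-- for all sufficiently large n, a_{⌊(1+ε)n⌋} / a_n > 1 + δ.
-- Note ⌊(1+p/q) n⌋ = ⌊(q+p) n / q⌋ (we divide by suc (pred q) = q since q ≥ 1);
-- and a_m / a_n > 1 + r/s ⇔ (s+r) a_n < s a_m.
WeaklyIncreasing : (ℕ → ℕ) → Set
WeaklyIncreasing a =
  ∀ p q → 1 ≤ p → 1 ≤ q →
    ∃[ r ] ∃[ s ] (1 ≤ r × 1 ≤ s ×
      ∃[ N ] (∀ n → N ≤ n →
        (s + r) * a n < s * a (((q + p) * n) / suc (pred q))))

_∈A#_ : ℕ → (ℕ → ℕ) → Set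
m ∈A# a = ∃[ i ] (1 ≤ i × a i ≡ m)

AtLeastInInitial : (ℕ → ℕ) → ℕ → ℕ → Set
AtLeastInInitial a n c =
  Σ (Fin c → ℕ) λ f → Injective _≡_ _≡_ f ×
    (∀ j → f j ∈A# a × 1 ≤ f j × f j ≤ n)

-- Lower asymptotic density of A^# equals 1:
-- since |A^# ∩ [1,n]| ≤ n always, this says for every ε = p/q > 0,
-- for all sufficiently large n, |A^# ∩ [1,n]| ≥ (1 - ε) n.
LowerDensityOne : (ℕ → ℕ) → Set
LowerDensityOne a =
  ∀ p q → 1 ≤ p → 1 ≤ q →
    ∃[ N ] (∀ n → N ≤ n →
      ∃[ c ] (q * n ≤ q * c + p * n × AtLeastInInitial a n c))

partialSum : (ℕ → ℕ) → ℕ → ℕ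
partialSum a zero    = 0
partialSum a (suc n) = partialSum a n + a (suc n)

Represents : (ℕ → ℕ) → ℕ → ℕ → ℕ → ℕ → Set
Represents a p q h n =
  1 ≤ n ×
  Σ (List ℕ) λ J →
    Unique J ×
    All (λ x → x ∈A# a × a n ≤ x × q * x ≤ (q + p) * a n) J ×
    h ≡ partialSum a n + sum J

{-# OPTIONS --safe #-}
-- Density one forces aₙ₊₁ / aₙ → 1, and it makes every large R a sum y + z of two elements
-- of A^# with y in a prescribed short window [lo, hi]: otherwise A^# ∩ [1, hi] and
-- R − (A^# ∩ [1, R − lo]) would be disjoint subsets of [1, R − 1] that are too large.
-- Given h, let n be maximal with Sₙ + (4q + 1) aₙ ≤ h (so n → ∞ with h). The remainder
-- T = h − Sₙ lies between (4q + 1) aₙ and about (4q + 2) aₙ; write T = 2q · 2c + ρ with ρ < 4q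
-- and realise it by 2q pairs with sums 2c + d (d ≤ 2), the ys taken from consecutive disjoint
-- windows just above aₙ. Then the zs decrease and stay below (1 + p/q) aₙ, so all the chosen
-- elements are distinct and lie in [aₙ, (1 + p/q) aₙ].
module Submission where

open import Defs
open import Data.Nat
open import Data.Nat.Properties
open import Data.Nat.DivMod
open import Data.Nat.ListAction using (sum)
open import Data.Nat.Tactic.RingSolver using (solve-∀)
open import Data.List using (List; []; _∷_)
open import Data.List.Relation.Unary.All as All using (All; []; _∷_)
open import Data.List.Relation.Unary.Unique.Propositional using (Unique)
open import Data.List.Relation.Unary.AllPairs.Core using ([]; _∷_)
open import Data.Product using (Σ; ∃-syntax; _×_; _,_; proj₁; proj₂)
open import Data.Sum using (_⊎_; inj₁; inj₂; [_,_]′)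
open import Data.Fin using (Fin; fromℕ<; splitAt; join)
import Data.Fin.Properties as Fin
open import Function.Base using (_∘_; _∘′_)
open import Function.Definitions using (Injective)
open import Relation.Nullary using (¬_; yes; no; contradiction)
open import Relation.Unary using (Pred; Decidable)
open import Relation.Binary.PropositionalEquality

injective⇒≤ : ∀ {c N} (f : Fin c → ℕ) → Injective _≡_ _≡_ f →
  (∀ i → 1 ≤ f i × f i ≤ N) → c ≤ N
injective⇒≤ {c} {N} f f-inj bounds = Fin.injective⇒≤ {f = index} index-inj
  where
  pred-f<N : ∀ i → pred (f i) < N
  pred-f<N i with f i | bounds i
  ... | suc v | _ , v<N = v<N

  index : Fin c → Fin N
  index i = fromℕ< (pred-f<N i)

  suc-pred-f : ∀ i → suc (pred (f i)) ≡ f i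
  suc-pred-f i with f i | bounds i
  ... | suc v | _ = refl

  index-inj : Injective _≡_ _≡_ index
  index-inj {i} {j} eq = f-inj (begin
    f i                  ≡⟨ sym (suc-pred-f i) ⟩
    suc (pred (f i))     ≡⟨ cong suc (Fin.fromℕ<-injective _ _ (pred-f<N i) (pred-f<N j) eq) ⟩
    suc (pred (f j))     ≡⟨ suc-pred-f j ⟩
    f j                  ∎)
    where open ≡-Reasoning

-- If no f i + g j equals R, then f and R − g together inject Fin (c₁ + c₂) into [1, R − 1].
pigeonhole-sum : ∀ {c₁ c₂ R} (f : Fin c₁ → ℕ) (g : Fin c₂ → ℕ) →
  Injective _≡_ _≡_ f → Injective _≡_ _≡_ g →
  (∀ i → 1 ≤ f i × f i < R) → (∀ j → 1 ≤ g j × g j < R) → 1 ≤ R → R ≤ c₁ + c₂ →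
  ∃[ i ] ∃[ j ] (f i + g j ≡ R)
pigeonhole-sum {c₁} {c₂} {R} f g f-inj g-inj f-bounds g-bounds 1≤R R≤c
  with Fin.any? (λ i → Fin.any? (λ j → f i + g j ≟ R))
... | yes (i , j , eq) = i , j , eq
... | no no-sum = contradiction R≤c (<⇒≱ (m≤pred[n]⇒suc[m]≤n {{>-nonZero 1≤R}} c≤pred-R))
  where
  complement : Fin c₂ → ℕ
  complement j = R ∸ g j

  complement+g : ∀ j → complement j + g j ≡ R
  complement+g j = m∸n+n≡m (<⇒≤ (proj₂ (g-bounds j)))

  h : Fin c₁ ⊎ Fin c₂ → ℕ
  h = [ f , complement ]′

  h-inj : Injective _≡_ _≡_ h
  h-inj {inj₁ i} {inj₁ i′} eq = cong inj₁ (f-inj eq)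
  h-inj {inj₂ j} {inj₂ j′} eq = cong inj₂ (g-inj (+-cancelˡ-≡ (complement j′) _ _
    (trans (cong (_+ g j) (sym eq)) (trans (complement+g j) (sym (complement+g j′))))))
  h-inj {inj₁ i} {inj₂ j} eq = contradiction (i , j , trans (cong (_+ g j) eq) (complement+g j)) no-sum
  h-inj {inj₂ j} {inj₁ i} eq = contradiction (i , j , trans (cong (_+ g j) (sym eq)) (complement+g j)) no-sum

  h-bounds : ∀ s → 1 ≤ h s × h s ≤ pred R
  h-bounds (inj₁ i) = proj₁ (f-bounds i) , <⇒≤pred (proj₂ (f-bounds i))
  h-bounds (inj₂ j) = m<n⇒0<n∸m (proj₂ (g-bounds j)) , ∸-monoʳ-≤ R (proj₁ (g-bounds j))

  c≤pred-R : c₁ + c₂ ≤ pred R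
  c≤pred-R = injective⇒≤ (h ∘′ splitAt c₁) splitAt-then-h-inj (λ x → h-bounds (splitAt c₁ x))
    where
    splitAt-then-h-inj : Injective _≡_ _≡_ (h ∘′ splitAt c₁)
    splitAt-then-h-inj {x} {y} eq = begin
      x                          ≡⟨ sym (Fin.join-splitAt c₁ c₂ x) ⟩
      join c₁ c₂ (splitAt c₁ x)  ≡⟨ cong (join c₁ c₂) (h-inj {splitAt c₁ x} {splitAt c₁ y} eq) ⟩
      join c₁ c₂ (splitAt c₁ y)  ≡⟨ Fin.join-splitAt c₁ c₂ y ⟩
      y                          ∎
      where open ≡-Reasoning

suc-mono⇒mono : ∀ (f : ℕ → ℕ) {k} → (∀ n → k ≤ n → f n ≤ f (suc n)) →
  ∀ {i j} → k ≤ i → i ≤ j → f i ≤ f j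
suc-mono⇒mono f {k} step {i} k≤i i≤j = go (≤⇒≤′ i≤j)
  where
  go : ∀ {j} → i ≤′ j → f i ≤ f j
  go ≤′-refl = ≤-refl
  go (≤′-step {n} i≤′n) = ≤-trans (go i≤′n) (step n (≤-trans k≤i (≤′⇒≤ i≤′n)))

last-satisfying : ∀ {p} {P : Pred ℕ p} → Decidable P → ∀ n d → P n → ¬ P (n + d) →
  ∃[ m ] (n ≤ m × P m × ¬ P (suc m))
last-satisfying {P = P} P? n zero Pn ¬P[n+0] = contradiction (subst P (sym (+-identityʳ n)) Pn) ¬P[n+0]
last-satisfying {P = P} P? n (suc d) Pn ¬P[n+1+d] with P? (suc n)
... | no ¬P[1+n] = n , ≤-refl , Pn , ¬P[1+n]
... | yes P[1+n] with last-satisfying P? (suc n) d P[1+n] (subst (λ k → ¬ P k) (+-suc n d) ¬P[n+1+d])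
...   | m , 1+n≤m , Pm , ¬P[1+m] = m , ≤-trans (n≤1+n n) 1+n≤m , Pm , ¬P[1+m]

partialSum-mono : ∀ (a : ℕ → ℕ) {i j} → i ≤ j → partialSum a i ≤ partialSum a j
partialSum-mono a = suc-mono⇒mono (partialSum a) (λ n _ → m≤m+n (partialSum a n) (a (suc n))) z≤n

module Multisubset {a : ℕ → ℕ} (A : IsMultisubset a) where
  open IsMultisubset A

  a-mono : ∀ {i j} → 1 ≤ i → i ≤ j → a i ≤ a j
  a-mono = suc-mono⇒mono a monotone

  n≤partialSum : ∀ n → n ≤ partialSum a n
  n≤partialSum zero    = z≤n
  n≤partialSum (suc n) = subst (_≤ partialSum a (suc n)) (+-comm n 1)
    (+-mono-≤ (n≤partialSum n) (positive (suc n) (s≤s z≤n)))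

  eventually-≥ : ∀ B → ∃[ n₀ ] (1 ≤ n₀ × ∀ n → n₀ ≤ n → B ≤ a n)
  eventually-≥ zero = 1 , ≤-refl , λ _ _ → z≤n
  eventually-≥ (suc B) with eventually-≥ B | finiteMult B
  ... | n₁ , 1≤n₁ , B≤a | bound , mult-B = suc (n₁ + bound) , s≤s z≤n , B<a
    where
    B<a : ∀ n → suc (n₁ + bound) ≤ n → suc B ≤ a n
    B<a n n>n₁+bound with B ≟ a n
    ... | no B≢aₙ = ≤∧≢⇒< (B≤a n (≤-trans (m≤m+n n₁ bound) (<⇒≤ n>n₁+bound))) B≢aₙ
    ... | yes B≡aₙ = contradiction (mult-B n (≤-trans (s≤s z≤n) n>n₁+bound) (sym B≡aₙ))
                       (<⇒≱ (≤-trans (s≤s (m≤n+m bound n₁)) n>n₁+bound))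

  ∈A#-below-next : ∀ {n x} → 1 ≤ n → x ∈A# a → x < a (suc n) → x ≤ a n
  ∈A#-below-next {n} 1≤n (i , 1≤i , refl) aᵢ<aₙ₊₁ with i ≤? n
  ... | yes i≤n = a-mono 1≤i i≤n
  ... | no i≰n  = contradiction (a-mono (s≤s z≤n) (≰⇒> i≰n)) (<⇒≱ aᵢ<aₙ₊₁)

Between : ℕ → ℕ → ℕ → Set
Between lo hi x = lo ≤ x × x ≤ hi

SumOfDistinct : (ℕ → ℕ) → (ℕ → Set) → ℕ → Set
SumOfDistinct a P s = Σ (List ℕ) λ J → Unique J × All (λ x → x ∈A# a × P x) J × sum J ≡ s

module _ {a : ℕ → ℕ} where

  SumOfDistinct-zero : ∀ {P} → SumOfDistinct a P 0
  SumOfDistinct-zero = [] , [] , [] , refl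

  SumOfDistinct-weaken : ∀ {P Q s} → (∀ {x} → P x → Q x) → SumOfDistinct a P s → SumOfDistinct a Q s
  SumOfDistinct-weaken P⇒Q (J , J-unique , J-in , ΣJ) = J , J-unique , All.map (λ (x∈A , Px) → x∈A , P⇒Q Px) J-in , ΣJ

  SumOfDistinct-insert : ∀ {P Q s x} → x ∈A# a → Q x → (∀ {w} → P w → Q w × w ≢ x) →
    SumOfDistinct a P s → SumOfDistinct a Q (x + s)
  SumOfDistinct-insert {x = x} x∈A Qx separate (J , J-unique , J-in , ΣJ) =
    x ∷ J , All.map (λ (_ , Pw) → ≢-sym (proj₂ (separate Pw))) J-in ∷ J-unique ,
    (x∈A , Qx) ∷ All.map (λ (w∈A , Pw) → w∈A , proj₁ (separate Pw)) J-in , cong (_ +_) ΣJ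

  SumOfDistinct-insert₂ : ∀ {P Q s y z} → y ∈A# a → z ∈A# a → Q y → Q z → y < z →
    (∀ {w} → P w → Q w × y < w × w < z) → SumOfDistinct a P s → SumOfDistinct a Q (y + (z + s))
  SumOfDistinct-insert₂ {Q = Q} {y = y} y∈A z∈A Qy Qz y<z separate =
    SumOfDistinct-insert y∈A Qy (λ (Qw , y<w) → Qw , >⇒≢ y<w)
    ∘ SumOfDistinct-insert {Q = λ w → Q w × y < w} z∈A (Qz , y<z)
        (λ Pw → let Qw , y<w , w<z = separate Pw in (Qw , y<w) , <⇒≢ w<z)

DenseBeyond : (ℕ → ℕ) → ℕ → ℕ → Set
DenseBeyond a F N₀ = ∀ N → N₀ ≤ N → ∃[ c ] (F * N ≤ suc F * c × AtLeastInInitial a N c)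

lowerDensityOne⇒denseBeyond : ∀ {a} → LowerDensityOne a → ∀ F → ∃[ N₀ ] DenseBeyond a F N₀
lowerDensityOne⇒denseBeyond ld F with ld 1 (suc F) ≤-refl (s≤s z≤n)
... | N₀ , dense = N₀ , λ N N₀≤N →
  let c , count , c-elements = dense N N₀≤N
  in c , +-cancelˡ-≤ N _ _ (≤-trans count (≤-reflexive (swap N c))) , c-elements
  where
  swap : ∀ N c → suc F * c + 1 * N ≡ N + suc F * c
  swap N c = trans (cong (suc F * c +_) (*-identityˡ N)) (+-comm (suc F * c) N)

ratio-bound : ∀ {F G X N} → 2 * G ≤ F → 2 * G ≤ X → F * N ≤ suc F * X → G * suc N ≤ (G + 1) * X
ratio-bound {G = zero} _ _ _ = z≤n
ratio-bound {F} {G@(suc _)} {X} {N} 2G≤F 2G≤X FN≤ with m≤n⇒∃[o]m+o≡n 2G≤F | m≤n⇒∃[o]m+o≡n 2G≤X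
... | r , refl | s , refl = *-cancelˡ-≤ F (begin
  F * (G * suc N)                            ≡⟨ distribute G F N ⟩
  G * (F * N) + F * G                        ≤⟨ +-monoˡ-≤ (F * G) (*-monoʳ-≤ G FN≤) ⟩
  G * (suc F * X) + F * G                    ≤⟨ m≤m+n _ (G * r + s * G + s * r) ⟩
  G * (suc F * X) + F * G + (G * r + s * G + s * r) ≡⟨ expand G r s ⟩
  F * ((G + 1) * X)                          ∎)
  where
  open ≤-Reasoning
  distribute : ∀ G F N → F * (G * suc N) ≡ G * (F * N) + F * G
  distribute = solve-∀
  expand : ∀ G r s → G * (suc (2 * G + r) * (2 * G + s)) + (2 * G + r) * G + (G * r + s * G + s * r)
                     ≡ (2 * G + r) * ((G + 1) * (2 * G + s))
  expand = solve-∀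

two-counts-cover : ∀ {F lo hi R c₁ c₂} → lo ≤ R → R + F * lo ≤ F * hi →
  F * hi ≤ suc F * c₁ → F * (R ∸ lo) ≤ suc F * c₂ → R ≤ c₁ + c₂
two-counts-cover {F} {lo} {hi} {R} {c₁} {c₂} lo≤R window count₁ count₂ = *-cancelˡ-≤ (suc F) (begin
  suc F * R                        ≡⟨ cong (λ t → R + F * t) (sym (m+[n∸m]≡n lo≤R)) ⟩
  R + F * (lo + (R ∸ lo))          ≡⟨ cong (R +_) (*-distribˡ-+ F lo (R ∸ lo)) ⟩
  R + (F * lo + F * (R ∸ lo))      ≡⟨ sym (+-assoc R (F * lo) _) ⟩
  R + F * lo + F * (R ∸ lo)        ≤⟨ +-monoˡ-≤ _ window ⟩
  F * hi + F * (R ∸ lo)            ≤⟨ +-mono-≤ count₁ count₂ ⟩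
  suc F * c₁ + suc F * c₂          ≡⟨ sym (*-distribˡ-+ (suc F) c₁ c₂) ⟩
  suc F * (c₁ + c₂)                ∎)
  where open ≤-Reasoning

module Dense {a : ℕ → ℕ} {F N₀ : ℕ} (dense : DenseBeyond a F N₀) where

  consecutive-ratio : IsMultisubset a → ∀ {G n} → 2 * G ≤ F → 1 ≤ n → 2 * G ≤ a n → N₀ < a (suc n) →
    G * a (suc n) ≤ (G + 1) * a n
  consecutive-ratio A {G} {n} 2G≤F 1≤n 2G≤aₙ N₀<aₙ₊₁ with dense (pred (a (suc n))) (<⇒≤pred N₀<aₙ₊₁)
  ... | c , count , f , f-inj , f-elements = subst (λ m → G * m ≤ (G + 1) * a n) suc-pred-aₙ₊₁
    (ratio-bound {G = G} 2G≤F 2G≤aₙ (≤-trans count (*-monoʳ-≤ (suc F) c≤aₙ)))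
    where
    open Multisubset A
    suc-pred-aₙ₊₁ : suc (pred (a (suc n))) ≡ a (suc n)
    suc-pred-aₙ₊₁ = suc-pred (a (suc n)) {{>-nonZero (≤-<-trans z≤n N₀<aₙ₊₁)}}
    c≤aₙ : c ≤ a n
    c≤aₙ = injective⇒≤ f f-inj λ j →
      let f∈A , 1≤f , f≤N = f-elements j
      in 1≤f , ∈A#-below-next 1≤n f∈A (≤-trans (s≤s f≤N) (≤-reflexive suc-pred-aₙ₊₁))

  pair-with-sum : ∀ {lo hi R} → 1 ≤ lo → N₀ ≤ lo → lo ≤ hi → hi < R → N₀ + lo ≤ R → R + F * lo ≤ F * hi →
    ∃[ y ] ∃[ z ] (y + z ≡ R × y ∈A# a × z ∈A# a × Between lo hi y)
  pair-with-sum {lo} {hi} {R} 1≤lo N₀≤lo lo≤hi hi<R N₀+lo≤R window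
    with dense hi (≤-trans N₀≤lo lo≤hi) | dense (R ∸ lo) (subst (_≤ R ∸ lo) (m+n∸n≡m N₀ lo) (∸-monoˡ-≤ lo N₀+lo≤R))
  ... | c₁ , count₁ , f , f-inj , f-elements | c₂ , count₂ , g , g-inj , g-elements
    with pigeonhole-sum f g f-inj g-inj
           (λ i → let _ , 1≤f , f≤hi = f-elements i in 1≤f , ≤-<-trans f≤hi hi<R)
           (λ j → let _ , 1≤g , g≤R∸lo = g-elements j in 1≤g , ≤-<-trans g≤R∸lo (∸-monoʳ-< 1≤lo (≤-trans lo≤hi (<⇒≤ hi<R))))
           (≤-trans (s≤s z≤n) hi<R)
           (two-counts-cover {F} {lo} {hi} {R} {c₁} {c₂} (≤-trans lo≤hi (<⇒≤ hi<R)) window count₁ count₂)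
  ... | i , j , fᵢ+gⱼ≡R =
    f i , g j , fᵢ+gⱼ≡R , proj₁ (f-elements i) , proj₁ (g-elements j) , lo≤fᵢ , proj₂ (proj₂ (f-elements i))
    where
    lo≤fᵢ : lo ≤ f i
    lo≤fᵢ = +-cancelˡ-≤ (g j) lo (f i) (begin
      g j + lo      ≤⟨ m≤o∸n⇒m+n≤o (g j) (≤-trans lo≤hi (<⇒≤ hi<R)) (proj₂ (proj₂ (g-elements j))) ⟩
      R             ≡⟨ sym fᵢ+gⱼ≡R ⟩
      f i + g j     ≡⟨ +-comm (f i) (g j) ⟩
      g j + f i     ∎)
      where open ≤-Reasoning

split-remainder : ∀ j {ρ} → ρ ≤ 2 * suc j → ∃[ d ] ∃[ ρ′ ] (d ≤ 2 × ρ′ ≤ 2 * j × d + ρ′ ≡ ρ)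
split-remainder j {0}           _  = 0 , 0 , z≤n , z≤n , refl
split-remainder j {1}           _  = 1 , 0 , s≤s z≤n , z≤n , refl
split-remainder j {suc (suc ρ)} ρ≤ = 2 , ρ , ≤-refl , s≤s⁻¹ (s≤s⁻¹ (subst (2 + ρ ≤_) (*-suc 2 j) ρ≤)) , refl

-- Pair number k uses y from the window [L + 2, L + 2 + u] and z = 2c + d − y, where the
-- next pair starts at L + stride; so the ys increase, the zs decrease, and all are distinct.
module Pairs {a : ℕ → ℕ} {F N₀ : ℕ} (dense : DenseBeyond a F N₀) {u c : ℕ} (window : 2 * c + 2 ≤ F * u) where
  open Dense {F = F} {N₀} dense

  stride : ℕ
  stride = 3 + u

  L+2+u<L+stride : ∀ L → L + 2 + u < L + stride
  L+2+u<L+stride L = ≤-reflexive (shift L u)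
    where
    shift : ∀ L u → suc (L + 2 + u) ≡ L + (3 + u)
    shift = solve-∀

  add-pair : ∀ j {d s L} → d ≤ 2 → N₀ ≤ L → L + suc j * stride ≡ c →
    SumOfDistinct a (Between (L + stride + 2) (c + j * stride)) s →
    SumOfDistinct a (Between (L + 2) (c + suc j * stride)) (2 * c + d + s)
  add-pair j {d} {s} {L} d≤2 N₀≤L L+[1+j]s≡c inner =
    insert-pair (pair-with-sum (≤-trans (s≤s z≤n) (m≤n+m 2 L)) (≤-trans N₀≤L (m≤m+n L 2))
                  (m≤m+n (L + 2) u) window<2c+d N₀+L+2≤2c+d fits)
    where
    open ≤-Reasoning

    c+L+[1+j]s≡2c : c + (L + suc j * stride) ≡ 2 * c
    c+L+[1+j]s≡2c = trans (cong (c +_) L+[1+j]s≡c) (cong (c +_) (sym (+-identityʳ c)))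

    L+stride≤c : L + stride ≤ c
    L+stride≤c = ≤-trans (m≤m+n (L + stride) (j * stride))
                   (≤-reflexive (trans (+-assoc L stride (j * stride)) L+[1+j]s≡c))

    L+2≤c : L + 2 ≤ c
    L+2≤c = ≤-trans (+-monoʳ-≤ L (s≤s (s≤s (z≤n {suc u})))) L+stride≤c

    c≤2c+d : c ≤ 2 * c + d
    c≤2c+d = ≤-trans (m≤m+n c (c + 0)) (m≤m+n (2 * c) d)

    window<2c+d : L + 2 + u < 2 * c + d
    window<2c+d = <-≤-trans (L+2+u<L+stride L) (≤-trans L+stride≤c c≤2c+d)

    N₀+L+2≤2c+d : N₀ + (L + 2) ≤ 2 * c + d
    N₀+L+2≤2c+d = ≤-trans (+-mono-≤ (≤-trans N₀≤L (≤-trans (m≤m+n L 2) L+2≤c)) L+2≤c)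
                    (≤-trans (≤-reflexive (cong (c +_) (sym (+-identityʳ c)))) (m≤m+n (2 * c) d))

    fits : 2 * c + d + F * (L + 2) ≤ F * (L + 2 + u)
    fits = begin
      2 * c + d + F * (L + 2)    ≤⟨ +-monoˡ-≤ (F * (L + 2)) (≤-trans (+-monoʳ-≤ (2 * c) d≤2) window) ⟩
      F * u + F * (L + 2)        ≡⟨ +-comm (F * u) (F * (L + 2)) ⟩
      F * (L + 2) + F * u        ≡⟨ sym (*-distribˡ-+ F (L + 2) u) ⟩
      F * (L + 2 + u)            ∎

    insert-pair : ∃[ y ] ∃[ z ] (y + z ≡ 2 * c + d × y ∈A# a × z ∈A# a × Between (L + 2) (L + 2 + u) y) →
      SumOfDistinct a (Between (L + 2) (c + suc j * stride)) (2 * c + d + s)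
    insert-pair (y , z , y+z≡2c+d , y∈A , z∈A , L+2≤y , y≤L+2+u) =
      subst (SumOfDistinct a (Between (L + 2) (c + suc j * stride))) (trans (sym (+-assoc y z s)) (cong (_+ s) y+z≡2c+d))
        (SumOfDistinct-insert₂ y∈A z∈A (L+2≤y , y≤top) (≤-trans L+2≤y (<⇒≤ y<z) , z≤top) y<z separate inner)
      where
      y<L+stride : y < L + stride
      y<L+stride = ≤-<-trans y≤L+2+u (L+2+u<L+stride L)

      L+stride≤top : L + stride ≤ c + j * stride
      L+stride≤top = ≤-trans L+stride≤c (m≤m+n c (j * stride))

      c+js<z : c + j * stride < z
      c+js<z = +-cancelˡ-≤ y _ _ (begin
        y + suc (c + j * stride)              ≤⟨ +-monoˡ-≤ _ y≤L+2+u ⟩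
        L + 2 + u + suc (c + j * stride)      ≡⟨ rearrange L u c j ⟩
        c + (L + suc j * stride)              ≡⟨ c+L+[1+j]s≡2c ⟩
        2 * c                                 ≤⟨ m≤m+n (2 * c) d ⟩
        2 * c + d                             ≡⟨ sym y+z≡2c+d ⟩
        y + z                                 ∎)
        where
        rearrange : ∀ L u c j → L + 2 + u + suc (c + j * (3 + u)) ≡ c + (L + suc j * (3 + u))
        rearrange = solve-∀

      y<z : y < z
      y<z = <-trans (<-≤-trans y<L+stride L+stride≤top) c+js<z

      y≤top : y ≤ c + suc j * stride
      y≤top = ≤-trans (<⇒≤ y<L+stride) (≤-trans L+stride≤c (m≤m+n c (suc j * stride)))

      z≤top : z ≤ c + suc j * stride
      z≤top = +-cancelʳ-≤ (L + 2) z _ (begin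
        z + (L + 2)                       ≤⟨ +-monoʳ-≤ z L+2≤y ⟩
        z + y                             ≡⟨ +-comm z y ⟩
        y + z                             ≡⟨ y+z≡2c+d ⟩
        2 * c + d                         ≤⟨ +-monoʳ-≤ (2 * c) d≤2 ⟩
        2 * c + 2                         ≡⟨ cong (_+ 2) (sym c+L+[1+j]s≡2c) ⟩
        c + (L + suc j * stride) + 2      ≡⟨ rearrange c L (suc j * stride) ⟩
        c + suc j * stride + (L + 2)      ∎)
        where
        rearrange : ∀ c L t → c + (L + t) + 2 ≡ c + t + (L + 2)
        rearrange = solve-∀

      separate : ∀ {w} → Between (L + stride + 2) (c + j * stride) w →
        Between (L + 2) (c + suc j * stride) w × y < w × w < z
      separate (lo≤w , w≤hi) =
        (≤-trans (+-monoˡ-≤ 2 (m≤m+n L stride)) lo≤w , ≤-trans w≤hi (+-monoʳ-≤ c (m≤n+m (j * stride) stride))) ,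
        <-≤-trans y<L+stride (≤-trans (m≤m+n (L + stride) 2) lo≤w) ,
        ≤-<-trans w≤hi c+js<z

  pairs : ∀ j {ρ L} → ρ ≤ 2 * j → N₀ ≤ L → L + j * stride ≡ c →
    SumOfDistinct a (Between (L + 2) (c + j * stride)) (j * (2 * c) + ρ)
  pairs zero    z≤n _ _ = SumOfDistinct-zero
  pairs (suc j) {ρ} {L} ρ≤ N₀≤L L+[1+j]s≡c with split-remainder j ρ≤
  ... | d , ρ′ , d≤2 , ρ′≤2j , refl =
    subst (SumOfDistinct a (Between (L + 2) (c + suc j * stride))) (regroup j c d ρ′)
      (add-pair j d≤2 N₀≤L L+[1+j]s≡c
        (pairs j ρ′≤2j (≤-trans N₀≤L (m≤m+n L stride)) (trans (+-assoc L stride (j * stride)) L+[1+j]s≡c)))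
    where
    regroup : ∀ j c d ρ′ → 2 * c + d + (j * (2 * c) + ρ′) ≡ suc j * (2 * c) + (d + ρ′)
    regroup = solve-∀

module Block (q p : ℕ) .{{_ : NonZero q}} (1≤p : 1 ≤ p) where
  open ≤-Reasoning

  M : ℕ
  M = 16 * q * q

  instance
    M≢0 : NonZero M
    M≢0 = m*n≢0 (16 * q) q {{m*n≢0 16 q}}

    4q≢0 : NonZero (4 * q)
    4q≢0 = m*n≢0 4 q

    8q≢0 : NonZero (8 * q)
    8q≢0 = m*n≢0 8 q

  48q²+8q≤8M : 48 * q * q + 8 * q ≤ 8 * M
  48q²+8q≤8M = begin
    48 * q * q + 8 * q                        ≤⟨ +-monoʳ-≤ (48 * q * q) (*-monoʳ-≤ 8 (m≤m*n q q)) ⟩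
    48 * q * q + 8 * (q * q)                  ≤⟨ m≤m+n _ (72 * q * q) ⟩
    48 * q * q + 8 * (q * q) + 72 * q * q     ≡⟨ collect q ⟩
    8 * M                                     ∎
    where
    collect : ∀ q → 48 * q * q + 8 * (q * q) + 72 * q * q ≡ 8 * (16 * q * q)
    collect = solve-∀

  2[8q+4]≤8M : 2 * (8 * q + 4) ≤ 8 * M
  2[8q+4]≤8M = begin
    2 * (8 * q + 4)                           ≡⟨ expand q ⟩
    16 * q + 8 * 1                            ≤⟨ +-mono-≤ (*-monoʳ-≤ 16 (m≤m*n q q)) (*-monoʳ-≤ 8 1≤q²) ⟩
    16 * (q * q) + 8 * (q * q)                ≤⟨ m≤m+n _ (104 * q * q) ⟩
    16 * (q * q) + 8 * (q * q) + 104 * q * q  ≡⟨ collect q ⟩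
    8 * M                                     ∎
    where
    1≤q² : 1 ≤ q * q
    1≤q² = >-nonZero⁻¹ (q * q) {{m*n≢0 q q}}
    expand : ∀ q → 2 * (8 * q + 4) ≡ 16 * q + 8 * 1
    expand = solve-∀
    collect : ∀ q → 16 * (q * q) + 8 * (q * q) + 104 * q * q ≡ 8 * (16 * q * q)
    collect = solve-∀

  c≤2X : ∀ {X c} → 8 * q * c ≤ (8 * q + 5) * X → c ≤ 2 * X
  c≤2X {X} {c} 8qc≤ = *-cancelˡ-≤ (8 * q) (begin
    8 * q * c                  ≤⟨ 8qc≤ ⟩
    (8 * q + 5) * X            ≤⟨ *-monoˡ-≤ X (+-monoʳ-≤ (8 * q) (≤-trans (m≤m+n 5 3) (m≤m*n 8 q))) ⟩
    (8 * q + 8 * q) * X        ≡⟨ double q X ⟩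
    8 * q * (2 * X)            ∎)
    where
    double : ∀ q X → (8 * q + 8 * q) * X ≡ 8 * q * (2 * X)
    double = solve-∀

  window-fits : ∀ {X u c} → X < M + u * M → 8 * M < X → c ≤ 2 * X → 2 * c + 2 ≤ 8 * M * u
  window-fits {X} {u} {c} X<M+uM 8M<X c≤2X = +-cancelˡ-≤ (8 * M) _ _ (begin
    8 * M + (2 * c + 2)                        ≤⟨ +-mono-≤ (<⇒≤ 8M<X) (+-monoˡ-≤ 2 (*-monoʳ-≤ 2 c≤2X)) ⟩
    X + (2 * (2 * X) + 2)                      ≤⟨ m≤m+n _ (3 * X + 6) ⟩
    X + (2 * (2 * X) + 2) + (3 * X + 6)        ≡⟨ collect X ⟩
    8 * suc X                                  ≤⟨ *-monoʳ-≤ 8 X<M+uM ⟩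
    8 * (M + u * M)                            ≡⟨ expand M u ⟩
    8 * M + 8 * M * u                          ∎)
    where
    collect : ∀ X → X + (2 * (2 * X) + 2) + (3 * X + 6) ≡ 8 * suc X
    collect = solve-∀
    expand : ∀ M u → 8 * (M + u * M) ≡ 8 * M + 8 * M * u
    expand = solve-∀

  lower-margin : ∀ {X T c ρ u} → T ≡ ρ + c * (4 * q) → ρ < 4 * q → (4 * q + 1) * X ≤ T →
    u * M ≤ X → 8 * M < X → X + 2 * q * (3 + u) ≤ c
  lower-margin {X} {T} {c} {ρ} {u} T≡ ρ<4q T-lower uM≤X 8M<X =
    <⇒≤ (*-cancelʳ-< (4 * q) _ c (+-cancelˡ-< (4 * q) _ _ (begin-strict
      4 * q + s * (4 * q)       ≡⟨ +-comm (4 * q) (s * (4 * q)) ⟩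
      s * (4 * q) + 4 * q       ≤⟨ *-cancelˡ-≤ 2 twice ⟩
      T                         ≡⟨ T≡ ⟩
      ρ + c * (4 * q)           <⟨ +-monoˡ-< (c * (4 * q)) ρ<4q ⟩
      4 * q + c * (4 * q)       ∎)))
    where
    s : ℕ
    s = X + 2 * q * (3 + u)
    small : 48 * q * q + 8 * q ≤ X
    small = ≤-trans 48q²+8q≤8M (<⇒≤ 8M<X)
    twice : 2 * (s * (4 * q) + 4 * q) ≤ 2 * T
    twice = begin
      2 * (s * (4 * q) + 4 * q)                          ≡⟨ expand X q u ⟩
      8 * q * X + u * (16 * q * q) + (48 * q * q + 8 * q)  ≤⟨ +-mono-≤ (+-monoʳ-≤ (8 * q * X) uM≤X) small ⟩
      8 * q * X + X + X                                  ≡⟨ collect q X ⟩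
      2 * ((4 * q + 1) * X)                              ≤⟨ *-monoʳ-≤ 2 T-lower ⟩
      2 * T                                              ∎
      where
      expand : ∀ X q u → 2 * ((X + 2 * q * (3 + u)) * (4 * q) + 4 * q)
                         ≡ 8 * q * X + u * (16 * q * q) + (48 * q * q + 8 * q)
      expand = solve-∀
      collect : ∀ q X → 8 * q * X + X + X ≡ 2 * ((4 * q + 1) * X)
      collect = solve-∀

  upper-margin : ∀ {X c u x} → 8 * q * c ≤ (8 * q + 5) * X → u * M ≤ X → 8 * M < X →
    x ≤ c + 2 * q * (3 + u) → q * x ≤ (q + p) * X
  upper-margin {X} {c} {u} {x} 8qc≤ uM≤X 8M<X x≤ = *-cancelˡ-≤ 8 (begin
    8 * (q * x)                                 ≤⟨ *-monoʳ-≤ 8 (*-monoʳ-≤ q x≤) ⟩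
    8 * (q * (c + 2 * q * (3 + u)))             ≡⟨ expand q c u ⟩
    8 * q * c + u * (16 * q * q) + 48 * q * q   ≤⟨ +-mono-≤ (+-mono-≤ 8qc≤ uM≤X) small ⟩
    (8 * q + 5) * X + X + X                     ≡⟨ collect q X ⟩
    8 * (q * X) + 7 * X                         ≤⟨ +-monoʳ-≤ (8 * (q * X)) (*-monoˡ-≤ X (≤-trans (n≤1+n 7) (*-monoʳ-≤ 8 1≤p))) ⟩
    8 * (q * X) + 8 * p * X                     ≡⟨ factor q p X ⟩
    8 * ((q + p) * X)                           ∎)
    where
    small : 48 * q * q ≤ X
    small = ≤-trans (m≤m+n _ (8 * q)) (≤-trans 48q²+8q≤8M (<⇒≤ 8M<X))
    expand : ∀ q c u → 8 * (q * (c + 2 * q * (3 + u))) ≡ 8 * q * c + u * (16 * q * q) + 48 * q * q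
    expand = solve-∀
    collect : ∀ q X → (8 * q + 5) * X + X + X ≡ 8 * (q * X) + 7 * X
    collect = solve-∀
    factor : ∀ q p X → 8 * (q * X) + 8 * p * X ≡ 8 * ((q + p) * X)
    factor = solve-∀

  block-sum : ∀ {a N₀} → DenseBeyond a (8 * M) N₀ → ∀ {X T} → N₀ ≤ X → 8 * M < X →
    (4 * q + 1) * X ≤ T → 2 * T ≤ (8 * q + 5) * X →
    SumOfDistinct a (λ x → X ≤ x × q * x ≤ (q + p) * X) T
  block-sum {a} dense {X} {T} N₀≤X 8M<X T-lower T-upper =
    subst (SumOfDistinct a _) sum-of-pairs
      (SumOfDistinct-weaken in-range (pairs (2 * q) ρ≤2[2q] (≤-trans N₀≤X X≤L) L+2q[3+u]≡c))
    where
    c ρ u : ℕ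
    c = T / (4 * q)
    ρ = T % (4 * q)
    u = X / M

    T≡ρ+c[4q] : T ≡ ρ + c * (4 * q)
    T≡ρ+c[4q] = m≡m%n+[m/n]*n T (4 * q)

    uM≤X : u * M ≤ X
    uM≤X = m/n*n≤m X M

    X<M+uM : X < M + u * M
    X<M+uM = subst (_< M + u * M) (sym (m≡m%n+[m/n]*n X M)) (+-monoˡ-< (u * M) (m%n<n X M))

    8qc≤ : 8 * q * c ≤ (8 * q + 5) * X
    8qc≤ = begin
      8 * q * c               ≡⟨ regroup q c ⟩
      2 * (c * (4 * q))       ≤⟨ *-monoʳ-≤ 2 (m/n*n≤m T (4 * q)) ⟩
      2 * T                   ≤⟨ T-upper ⟩
      (8 * q + 5) * X         ∎
      where
      regroup : ∀ q c → 8 * q * c ≡ 2 * (c * (4 * q))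
      regroup = solve-∀

    open Pairs {F = 8 * M} dense {u} {c} (window-fits {X} {u} {c} X<M+uM 8M<X (c≤2X 8qc≤))

    margin : X + 2 * q * (3 + u) ≤ c
    margin = lower-margin T≡ρ+c[4q] (m%n<n T (4 * q)) T-lower uM≤X 8M<X

    L : ℕ
    L = c ∸ 2 * q * (3 + u)

    X≤L : X ≤ L
    X≤L = m+n≤o⇒m≤o∸n X margin

    L+2q[3+u]≡c : L + 2 * q * (3 + u) ≡ c
    L+2q[3+u]≡c = m∸n+n≡m (m+n≤o⇒n≤o X margin)

    ρ≤2[2q] : ρ ≤ 2 * (2 * q)
    ρ≤2[2q] = ≤-trans (<⇒≤ (m%n<n T (4 * q))) (≤-reflexive (*-assoc 2 2 q))

    in-range : ∀ {x} → Between (L + 2) (c + 2 * q * (3 + u)) x → X ≤ x × q * x ≤ (q + p) * X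
    in-range (L+2≤x , x≤top) = ≤-trans X≤L (≤-trans (m≤m+n L 2) L+2≤x) , upper-margin 8qc≤ uM≤X 8M<X x≤top

    sum-of-pairs : 2 * q * (2 * c) + ρ ≡ T
    sum-of-pairs = trans (regroup q c ρ) (sym T≡ρ+c[4q])
      where
      regroup : ∀ q c ρ → 2 * q * (2 * c) + ρ ≡ ρ + c * (4 * q)
      regroup = solve-∀

module Construction {a : ℕ → ℕ} (A : IsMultisubset a) (q p : ℕ) .{{_ : NonZero q}} (1≤p : 1 ≤ p)
  {N₀ : ℕ} (dense : DenseBeyond a (8 * (16 * q * q)) N₀) where
  open Multisubset A
  open Block q p 1≤p
  open Dense {F = 8 * M} dense

  Fits : ℕ → ℕ → Set
  Fits h n = partialSum a n + (4 * q + 1) * a n ≤ h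

  Fits-antitone : ∀ {h i j} → 1 ≤ i → i ≤ j → Fits h j → Fits h i
  Fits-antitone 1≤i i≤j = ≤-trans (+-mono-≤ (partialSum-mono a i≤j) (*-monoʳ-≤ (4 * q + 1) (a-mono 1≤i i≤j)))

  n₀ : ℕ
  n₀ = proj₁ (eventually-≥ (suc (N₀ + 8 * M)))

  1≤n₀ : 1 ≤ n₀
  1≤n₀ = proj₁ (proj₂ (eventually-≥ (suc (N₀ + 8 * M))))

  large : ∀ n → n₀ ≤ n → suc (N₀ + 8 * M) ≤ a n
  large = proj₂ (proj₂ (eventually-≥ (suc (N₀ + 8 * M))))

  H : ℕ
  H = partialSum a n₀ + (4 * q + 1) * a n₀

  last-fit : ∀ h → H ≤ h → ∃[ m ] (n₀ ≤ m × Fits h m × ¬ Fits h (suc m))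
  last-fit h H≤h = last-satisfying (λ n → partialSum a n + (4 * q + 1) * a n ≤? h) n₀ (suc h) H≤h
    λ fits → contradiction (≤-trans (m≤n+m (suc h) n₀) (≤-trans (n≤partialSum (n₀ + suc h)) (m+n≤o⇒m≤o _ fits))) (n≮n h)

  nOf : ℕ → ℕ
  nOf h with H ≤? h
  ... | yes H≤h = proj₁ (last-fit h H≤h)
  ... | no _    = n₀

  nOf-last-fit : ∀ h → H ≤ h → n₀ ≤ nOf h × Fits h (nOf h) × ¬ Fits h (suc (nOf h))
  nOf-last-fit h H≤h with H ≤? h
  ... | yes H≤h′ = proj₂ (last-fit h H≤h′)
  ... | no H≰h   = contradiction H≤h H≰h

  represents-at-last-fit : ∀ {h m} → n₀ ≤ m → Fits h m → ¬ Fits h (suc m) → Represents a p q h m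
  represents-at-last-fit {h} {m} n₀≤m fits ¬fits = finish (block-sum dense N₀≤aₘ 8M<aₘ T-lower T-upper)
    where
    S T : ℕ
    S = partialSum a m
    T = h ∸ S

    S+T≡h : S + T ≡ h
    S+T≡h = m+[n∸m]≡n (m+n≤o⇒m≤o S fits)

    N₀≤aₘ : N₀ ≤ a m
    N₀≤aₘ = ≤-trans (m≤m+n N₀ (8 * M)) (≤-trans (n≤1+n _) (large m n₀≤m))

    8M<aₘ : 8 * M < a m
    8M<aₘ = ≤-trans (s≤s (m≤n+m (8 * M) N₀)) (large m n₀≤m)

    T-lower : (4 * q + 1) * a m ≤ T
    T-lower = +-cancelˡ-≤ S _ _ (≤-trans fits (≤-reflexive (sym S+T≡h)))

    T<[4q+2]aₘ₊₁ : T < (4 * q + 2) * a (suc m)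
    T<[4q+2]aₘ₊₁ = +-cancelˡ-< S _ _ (begin-strict
      S + T                                              ≡⟨ S+T≡h ⟩
      h                                                  <⟨ ≰⇒> ¬fits ⟩
      S + a (suc m) + (4 * q + 1) * a (suc m)            ≡⟨ regroup S (a (suc m)) q ⟩
      S + (4 * q + 2) * a (suc m)                        ∎)
      where
      open ≤-Reasoning
      regroup : ∀ S x q → S + x + (4 * q + 1) * x ≡ S + (4 * q + 2) * x
      regroup = solve-∀

    T-upper : 2 * T ≤ (8 * q + 5) * a m
    T-upper = begin
      2 * T                           ≤⟨ *-monoʳ-≤ 2 (<⇒≤ T<[4q+2]aₘ₊₁) ⟩
      2 * ((4 * q + 2) * a (suc m))   ≡⟨ regroup q (a (suc m)) ⟩
      (8 * q + 4) * a (suc m)         ≤⟨ consecutive-ratio A {8 * q + 4} 2[8q+4]≤8M (≤-trans 1≤n₀ n₀≤m) (≤-trans 2[8q+4]≤8M (<⇒≤ 8M<aₘ)) N₀<aₘ₊₁ ⟩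
      (8 * q + 4 + 1) * a m           ≡⟨ cong (_* a m) (+-assoc (8 * q) 4 1) ⟩
      (8 * q + 5) * a m               ∎
      where
      open ≤-Reasoning
      regroup : ∀ q x → 2 * ((4 * q + 2) * x) ≡ (8 * q + 4) * x
      regroup = solve-∀
      N₀<aₘ₊₁ : N₀ < a (suc m)
      N₀<aₘ₊₁ = ≤-trans (s≤s (m≤m+n N₀ (8 * M))) (large (suc m) (m≤n⇒m≤1+n n₀≤m))

    finish : SumOfDistinct a (λ x → a m ≤ x × q * x ≤ (q + p) * a m) T → Represents a p q h m
    finish (J , J-unique , J-in , ΣJ) = ≤-trans 1≤n₀ n₀≤m , J , J-unique , J-in , trans (sym S+T≡h) (cong (S +_) (sym ΣJ))

  represents : ∀ h → H ≤ h → Represents a p q h (nOf h)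
  represents h H≤h = let n₀≤m , fits , ¬fits = nOf-last-fit h H≤h in represents-at-last-fit n₀≤m fits ¬fits

  nOf-unbounded : ∀ B → ∃[ K ] (∀ h → K ≤ h → B ≤ nOf h)
  nOf-unbounded B = H + (partialSum a (B + n₀) + (4 * q + 1) * a (B + n₀)) , B≤nOf
    where
    B≤nOf : ∀ h → H + (partialSum a (B + n₀) + (4 * q + 1) * a (B + n₀)) ≤ h → B ≤ nOf h
    B≤nOf h K≤h with nOf-last-fit h (m+n≤o⇒m≤o H K≤h) | B + n₀ ≤? nOf h
    ... | _ | yes B+n₀≤nOf = m+n≤o⇒m≤o B B+n₀≤nOf
    ... | _ , _ , ¬fits | no B+n₀≰nOf = contradiction (Fits-antitone (s≤s z≤n) (≰⇒> B+n₀≰nOf) (m+n≤o⇒n≤o H K≤h)) ¬fits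

lemma4p2 : (a : ℕ → ℕ) → IsMultisubset a → WeaklyIncreasing a → LowerDensityOne a →
    ∀ p q → 1 ≤ p → 1 ≤ q →
      ∃[ H ] Σ (ℕ → ℕ) λ nOf →
        (∀ h → H ≤ h → Represents a p q h (nOf h)) ×
        (∀ M → ∃[ K ] (∀ h → K ≤ h → M ≤ nOf h))
lemma4p2 a A _ density-one p (suc q) 1≤p _ with lowerDensityOne⇒denseBeyond density-one (8 * (16 * suc q * suc q))
... | N₀ , dense = H , nOf , represents , nOf-unbounded
  where open Construction A (suc q) p 1≤p dense
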